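{- Let $q\ge2$ and $n\ge1$ be integers. Under each of the scenarios $(**)$ and $(\bullet *)$, the family $\mathcal{G}_q\cup\mathcal{L}_q$ is $n$-cell implementable if and only if $q\le 2$ when $n=1$, and $q\le 2n-1$ when $n\ge2$, where $\mathcal{G}_q=\{x\mapsto[\![x\ge t]\!]\}_{t\in[q\rangle}$ and $\mathcal{L}_q=\{x\mapsto[\![x\le t]\!]\}_{t\in[q\rangle}$.
   Context: $[b\rangle=\{0,1,\ldots,b-1\}$. Let $\mathbb{B}=\{0,1\}$, $\mathbb{B}_\circ=\mathbb{B}$, $\mathbb{B}_*=\mathbb{B}\cup\{*\}$, $\mathbb{B}_\bullet=\mathbb{B}\cup\{*,\bullet\}$. Define $\mathrm{T}:\mathbb{B}_\bullet^2\to\mathbb{B}$ by $\mathrm{T}(u,\vartheta)=1$ if and only if $u=*$, or $\vartheta=*$, or $u=\vartheta\in\mathbb{B}$. $[\![\cdot]\!]$ is the Iverson bracket. $\mathcal{F}_q$ is the set of all functions $[q\rangle\to\mathbb{B}$. For $\alpha,\beta\in\{\circ,*,\bullet\}$, a subset $\Phi\subseteq\mathcal{F}_q$ is $n$-cell implementable under scenario $(\alpha\beta)$ if there exist mappings $\mathbf{u}=(u_j)_{j\in[n\rangle}:[q\rangle\to\mathbb{B}_\alpha^n$ and $\boldsymbol{\vartheta}=(\vartheta_j)_{j\in[n\rangle}:\Phi\to\mathbb{B}_\beta^n$ such that $f(x)=\bigwedge_{j\in[n\rangle}\mathrm{T}(u_j(x),\vartheta_j(f))$ for all $f\in\Phi$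 and $x\in[q\rangle$. -}

module Defs where

open import Data.Nat using (ℕ; zero; suc; _≤_; _∸_; _*_)
open import Data.Fin using (Fin; toℕ)
open import Data.Bool using (Bool; true; false; _∧_)
open import Data.Nat using (_≤ᵇ_)
open import Data.Vec.Functional using (Vector; foldr)
open import Data.Product using (Σ; _×_; ∃)
open import Relation.Binary.PropositionalEquality using (_≡_)

data Sym : Set where
  s0 s1 s* s• : Sym

-- Scenarios' alphabets: ∘ ↦ 𝔹, * ↦ 𝔹 ∪ {*}, • ↦ 𝔹 ∪ {*,•}
data Alph : Set where
  ∘ ⋆ ● : Alph

data _∈ₐ_ : Sym → Alph → Set where
  0∈∘ : s0 ∈ₐ ∘
  1∈∘ : s1 ∈ₐ ∘
  0∈⋆ : s0 ∈ₐ ⋆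
  1∈⋆ : s1 ∈ₐ ⋆
  *∈⋆ : s* ∈ₐ ⋆
  0∈● : s0 ∈ₐ ●
  1∈● : s1 ∈ₐ ●
  *∈● : s* ∈ₐ ●
  •∈● : s• ∈ₐ ●

T : Sym → Sym → Bool
T s* _  = true
T _  s* = true
T s0 s0 = true
T s1 s1 = true
T _  _  = false

⋀ : ∀ {n} → Vector Bool n → Bool
⋀ = foldr _∧_ true

𝓕 : ℕ → Set
𝓕 q = Fin q → Bool

G : ∀ {q} → Fin q → 𝓕 q
G t x = toℕ t ≤ᵇ toℕ x

L : ∀ {q} → Fin q → 𝓕 q
L t x = toℕ x ≤ᵇ toℕ t

-- The map ϑ is given on all of 𝓕 q; only its values on members of the family
-- matter (any map on the family extends, since 𝔹_β is nonempty).
GLImplementable : Alph → Alph → (q n : ℕ) → Set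
GLImplementable α β q n =
  Σ (Fin q → Fin n → Sym) λ u →
  Σ (𝓕 q → Fin n → Sym) λ ϑ →
    (∀ x j → u x j ∈ₐ α) ×
    (∀ f j → ϑ f j ∈ₐ β) ×
    (∀ t x → G t x ≡ ⋀ (λ j → T (u x j) (ϑ (G t) j))) ×
    (∀ t x → L t x ≡ ⋀ (λ j → T (u x j) (ϑ (L t) j)))

bound : ℕ → ℕ
bound 1 = 2
bound n = 2 * n ∸ 1

-- A slot (j , b) is cell j receiving ϑ_j = b. Since T u * = 1, a member of the family
-- vanishes at x exactly when one of its slots is contradicted by the reading u_j(x), and such
-- a slot then kills only zeros of that member. The slots forcing G_{i+1}(i) = 0 kill only
-- points ≤ i and those forcing L_i(i+1) = 0 only points > i, so each kind gives q − 1
-- distinct slots; the first left slot is no right slot and the last right slot no left slot.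
-- If moreover some other left slot is no right slot, or some slot used by G_{q−1} is no left
-- slot, there are q + 1 distinct slots among the 2n, so q ≤ 2n − 1. Otherwise the left slot
-- at i equals the right slot at i − 1, so it kills i alone, and G_{q−1} needs a separate cell
-- for each of its q − 1 zeros.
--
-- Conversely, for n ≥ 3 put the points 0, …, q − 1 between consecutive edges 0, …, q and give
-- each cell one even and one odd edge, not adjacent to each other. A cell reads 0 or 1 at the
-- points touching its even or odd edge. G_t chooses the edges below t of parity opposite to t,
-- L_t those beyond t + 1 of the parity of t: every zero touches a chosen edge and no other point
-- does, and each cell is sent the negated bit of its chosen edge. The cases n ≤ 2 are tables.

module Submission where

open import Defs
open import Data.Bool using (Bool; true; false; not; _∧_; if_then_else_)
open import Data.Bool.Properties using (∧-zeroʳ) renaming (_≟_ to _≟ᵇ_)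
open import Data.Empty using (⊥-elim)
open import Data.Fin using (Fin; zero; suc; toℕ; inject₁; fromℕ; fromℕ<)
open import Data.Fin.Properties
  using (toℕ-injective; suc-injective; toℕ-inject₁; toℕ-fromℕ; toℕ-fromℕ<; toℕ<n; toℕ≤pred[n];
         all?; any?; ¬∀⟶∃¬; injective⇒≤; injective⇒existsPivot; *↔×; 2↔Bool)
  renaming (_≟_ to _≟ᶠ_)
open import Data.Maybe using (Maybe; just; nothing)
open import Data.Nat using (ℕ; zero; suc; _+_; _*_; _≤_; _<_; z≤n; s≤s; s≤s⁻¹; z<s; ⌊_/2⌋; ⌈_/2⌉)
import Data.Nat.Properties as ℕ
open import Data.Product using (∃; _×_; _,_; proj₁; proj₂)
open import Data.Product.Function.NonDependent.Propositional using (_×-↔_)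
open import Data.Product.Properties using (≡-dec)
open import Data.Sum using (_⊎_; inj₁; inj₂; [_,_]; map)
open import Data.Vec.Functional using ([]; _∷_)
open import Function using (_∘′_; id; _⇔_; mk⇔; _↔_; Injective; Injection)
open import Function.Bundles using (Equivalence)
open import Function.Construct.Composition using (_⇔-∘_)
open import Function.Construct.Symmetry using (⇔-sym)
open import Function.Properties.Inverse using (↔-refl; ↔-sym; ↔-trans; ↔⇒↣)
open import Relation.Binary.PropositionalEquality using (_≡_; _≢_; _≗_; refl; sym; trans; cong; cong₂; subst)
open import Relation.Nullary using (Dec; yes; no; ¬_; does)
open import Relation.Nullary.Decidable using (from-yes; _×-dec_)
open import Relation.Unary using (Decidable)
open import Relation.Binary.Definitions using (tri<; tri≈; tri>)

open Equivalence using (to; from)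

⋀≡false⇔ : ∀ {n} {v : Fin n → Bool} → ⋀ v ≡ false ⇔ ∃ λ j → v j ≡ false
⋀≡false⇔ = mk⇔ to′ from′
  where
  to′ : ∀ {n} {v : Fin n → Bool} → ⋀ v ≡ false → ∃ λ j → v j ≡ false
  to′ {zero} ()
  to′ {suc n} {v} ⋀v≡false with v zero in v₀≡
  ... | false = zero , v₀≡
  ... | true  = let j , vj≡ = to′ ⋀v≡false in suc j , vj≡
  from′ : ∀ {n} {v : Fin n → Bool} → ∃ (λ j → v j ≡ false) → ⋀ v ≡ false
  from′ (zero  , v₀≡) rewrite v₀≡ = refl
  from′ {v = v} (suc j , vj≡) = trans (cong (v zero ∧_) (from′ (j , vj≡))) (∧-zeroʳ (v zero))

≡false⇔⇒≡ : ∀ {a b : Bool} → a ≡ false ⇔ b ≡ false → a ≡ b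
≡false⇔⇒≡ {false} {false} _ = refl
≡false⇔⇒≡ {true}  {true}  _ = refl
≡false⇔⇒≡ {false} {true}  a⇔b with () ← to a⇔b refl
≡false⇔⇒≡ {true}  {false} a⇔b with () ← from a⇔b refl

does≡false⇔ : ∀ {A : Set} (a? : Dec A) → does a? ≡ false ⇔ (¬ A)
does≡false⇔ (yes a) = mk⇔ (λ ()) (λ ¬a → ⊥-elim (¬a a))
does≡false⇔ (no ¬a) = mk⇔ (λ _ → ¬a) (λ _ → refl)

G≡false⇔ : ∀ {q} (t x : Fin q) → G t x ≡ false ⇔ toℕ x < toℕ t
G≡false⇔ t x = mk⇔ ℕ.≰⇒> ℕ.<⇒≱ ⇔-∘ does≡false⇔ (toℕ t ℕ.≤? toℕ x)

L≡false⇔ : ∀ {q} (t x : Fin q) → L t x ≡ false ⇔ toℕ t < toℕ x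
L≡false⇔ t x = G≡false⇔ x t

bit : Bool → Sym
bit false = s0
bit true  = s1

bit-injective : Injective _≡_ _≡_ bit
bit-injective {false} {false} _ = refl
bit-injective {true}  {true}  _ = refl

toSym : Maybe Bool → Sym
toSym nothing  = s*
toSym (just b) = bit b

toSym∈⋆ : ∀ a → toSym a ∈ₐ ⋆
toSym∈⋆ nothing      = *∈⋆
toSym∈⋆ (just false) = 0∈⋆
toSym∈⋆ (just true)  = 1∈⋆

T-s*≢false : ∀ a → T a s* ≢ false
T-s*≢false s0 ()
T-s*≢false s1 ()
T-s*≢false s* ()
T-s*≢false s• ()

T-toSym-bit-not≡false⇔ : ∀ {a p} → T (toSym a) (bit (not p)) ≡ false ⇔ a ≡ just p
T-toSym-bit-not≡false⇔ {nothing}    {false} = mk⇔ (λ ()) (λ ())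
T-toSym-bit-not≡false⇔ {nothing}    {true}  = mk⇔ (λ ()) (λ ())
T-toSym-bit-not≡false⇔ {just false} {false} = mk⇔ (λ _ → refl) (λ _ → refl)
T-toSym-bit-not≡false⇔ {just false} {true}  = mk⇔ (λ ()) (λ ())
T-toSym-bit-not≡false⇔ {just true}  {false} = mk⇔ (λ ()) (λ ())
T-toSym-bit-not≡false⇔ {just true}  {true}  = mk⇔ (λ _ → refl) (λ _ → refl)

⋆-killer-is-bit : ∀ {a θ} → θ ∈ₐ ⋆ → T a θ ≡ false → ∃ λ b → θ ≡ bit b
⋆-killer-is-bit     0∈⋆ _ = false , refl
⋆-killer-is-bit     1∈⋆ _ = true , refl
⋆-killer-is-bit {a} *∈⋆ Ta*≡false = ⊥-elim (T-s*≢false a Ta*≡false)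

Implements : ∀ {q n} → (Fin q → Fin n → Sym) → 𝓕 q → (Fin n → Sym) → Set
Implements u f θ = ∀ x → f x ≡ ⋀ (λ j → T (u x j) (θ j))

Slot : ℕ → Set
Slot n = Fin n × Bool

_≟ˢ_ : ∀ {n} (s s′ : Slot n) → Dec (s ≡ s′)
_≟ˢ_ = ≡-dec _≟ᶠ_ _≟ᵇ_

Slot↔Fin : ∀ {n} → Slot n ↔ Fin (n * 2)
Slot↔Fin = ↔-trans (↔-refl ×-↔ ↔-sym 2↔Bool) (↔-sym *↔×)

slot-count : ∀ {k n} {g : Fin k → Slot n} → Injective _≡_ _≡_ g → k ≤ n + n
slot-count {k} {n} g-injective =
  subst (k ≤_) (trans (ℕ.*-comm n 2) (cong (n +_) (ℕ.+-identityʳ n)))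
    (injective⇒≤ (λ eq → g-injective (Injection.injective (↔⇒↣ Slot↔Fin) eq)))

fresh-∷-injective : ∀ {A : Set} {k} {a : A} {g : Fin k → A} →
  (∀ i → g i ≢ a) → Injective _≡_ _≡_ g → Injective _≡_ _≡_ (a ∷ g)
fresh-∷-injective fresh g-injective {zero}  {zero}  _  = refl
fresh-∷-injective fresh g-injective {zero}  {suc j} eq = ⊥-elim (fresh j (sym eq))
fresh-∷-injective fresh g-injective {suc i} {zero}  eq = ⊥-elim (fresh i eq)
fresh-∷-injective fresh g-injective {suc i} {suc j} eq = cong suc (g-injective eq)

deflationary-injective⇒toℕ-id : ∀ {m n} {f : Fin m → Fin n} → Injective _≡_ _≡_ f →
  (∀ i → toℕ (f i) ≤ toℕ i) → ∀ i → toℕ (f i) ≡ toℕ i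
deflationary-injective⇒toℕ-id f-injective f≤id i
  with j , j≤i , i≤fj ← injective⇒existsPivot f-injective i
  with refl ← toℕ-injective (ℕ.≤-antisym j≤i (ℕ.≤-trans i≤fj (f≤id j)))
  = ℕ.≤-antisym (f≤id i) i≤fj

module SlotIntervals {m n : ℕ} (_kills_ : Slot n → ℕ → Set)
  (left right cover : Fin (suc m) → Slot n)
  (left-kills  : ∀ i → left i kills toℕ i)
  (left-below  : ∀ i {y} → left i kills y → y ≤ toℕ i)
  (right-kills : ∀ i → right i kills suc (toℕ i))
  (right-above : ∀ i {y} → right i kills y → toℕ i < y)
  (cover-kills : ∀ p → cover p kills toℕ p)
  (cover-below : ∀ p {y} → cover p kills y → y ≤ m)
  (cover-by-cell : ∀ {p p′} → proj₁ (cover p) ≡ proj₁ (cover p′) → cover p ≡ cover p′)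
  where

  private
    transport : ∀ {s s′ y} → s ≡ s′ → s kills y → s′ kills y
    transport refl k = k

  left-injective : Injective _≡_ _≡_ left
  left-injective {i} {i′} eq = toℕ-injective (ℕ.≤-antisym
    (left-below i′ (transport eq (left-kills i)))
    (left-below i (transport (sym eq) (left-kills i′))))

  right-injective : Injective _≡_ _≡_ right
  right-injective {i} {i′} eq = toℕ-injective (ℕ.≤-antisym
    (s≤s⁻¹ (right-above i (transport (sym eq) (right-kills i′))))
    (s≤s⁻¹ (right-above i′ (transport eq (right-kills i)))))

  right≢left₀ : ∀ r → right r ≢ left zero
  right≢left₀ r eq = ℕ.n≮0 (right-above r (transport (sym eq) (left-kills zero)))

  right-top-kills : right (fromℕ m) kills suc m
  right-top-kills = subst (λ y → right (fromℕ m) kills suc y) (toℕ-fromℕ m) (right-kills (fromℕ m))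

  left≢right-top : ∀ i → left i ≢ right (fromℕ m)
  left≢right-top i eq =
    ℕ.1+n≰n (ℕ.≤-trans (left-below i (transport (sym eq) right-top-kills)) (toℕ≤pred[n] i))

  cover≢right-top : ∀ p → cover p ≢ right (fromℕ m)
  cover≢right-top p eq = ℕ.1+n≰n (cover-below p (transport (sym eq) right-top-kills))

  LeftIsRight : Fin m → Set
  LeftIsRight r = ∃ λ r′ → right r′ ≡ left (suc r)

  CoverIsLeft : Fin (suc m) → Set
  CoverIsLeft p = ∃ λ i → left i ≡ cover p

  leftIsRight? : Decidable LeftIsRight
  leftIsRight? r = any? (λ r′ → right r′ ≟ˢ left (suc r))

  coverIsLeft? : Decidable CoverIsLeft
  coverIsLeft? p = any? (λ i → left i ≟ˢ cover p)

  extra-left : ∀ r → ¬ LeftIsRight r → suc (suc (suc m)) ≤ n + n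
  extra-left r ¬left-is-right =
    slot-count (fresh-∷-injective fresh (fresh-∷-injective right≢left₀ right-injective))
    where
    fresh : ∀ i → (left zero ∷ right) i ≢ left (suc r)
    fresh zero    eq with () ← left-injective eq
    fresh (suc i) eq = ¬left-is-right (i , eq)

  extra-cover : ∀ p → ¬ CoverIsLeft p → suc (suc (suc m)) ≤ n + n
  extra-cover p ¬cover-is-left =
    slot-count (fresh-∷-injective fresh (fresh-∷-injective left≢right-top left-injective))
    where
    fresh : ∀ i → (right (fromℕ m) ∷ left) i ≢ cover p
    fresh zero    eq = cover≢right-top p (sym eq)
    fresh (suc i) eq = ¬cover-is-left (i , eq)

  -- Here left (suc r) = right (φ r) forces φ = id, so left i kills only i.
  module _ (lefts-are-rights : ∀ r → LeftIsRight r) (covers-are-lefts : ∀ p → CoverIsLeft p) where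

    private
      φ : Fin m → Fin (suc m)
      φ r = proj₁ (lefts-are-rights r)

      φ-spec : ∀ r → right (φ r) ≡ left (suc r)
      φ-spec r = proj₂ (lefts-are-rights r)

    toℕ-φ : ∀ r → toℕ (φ r) ≡ toℕ r
    toℕ-φ = deflationary-injective⇒toℕ-id φ-injective φ-deflationary
      where
      φ-injective : Injective _≡_ _≡_ φ
      φ-injective {r} {r′} eq =
        suc-injective (left-injective (trans (sym (φ-spec r)) (trans (cong right eq) (φ-spec r′))))
      φ-deflationary : ∀ r → toℕ (φ r) ≤ toℕ r
      φ-deflationary r = s≤s⁻¹ (left-below (suc r) (transport (φ-spec r) (right-kills (φ r))))

    left-above : ∀ i {y} → left i kills y → toℕ i ≤ y
    left-above zero    _ = z≤n
    left-above (suc r) k = subst (_< _) (toℕ-φ r) (right-above (φ r) (transport (sym (φ-spec r)) k))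

    cover≡left : ∀ p → cover p ≡ left p
    cover≡left p =
      let i , left-i≡cover-p = covers-are-lefts p
          kills-p = transport (sym left-i≡cover-p) (cover-kills p)
      in trans (sym left-i≡cover-p)
               (cong left (toℕ-injective (ℕ.≤-antisym (left-above i kills-p) (left-below i kills-p))))

    cover-cells-injective : Injective _≡_ _≡_ (proj₁ ∘′ cover)
    cover-cells-injective {p} {p′} eq =
      left-injective (trans (sym (cover≡left p)) (trans (cover-by-cell eq) (cover≡left p′)))

  slots-bound : suc m ≤ n ⊎ suc (suc (suc m)) ≤ n + n
  slots-bound with all? leftIsRight? | all? coverIsLeft?
  ... | yes lefts-are-rights | yes covers-are-lefts =
    inj₁ (injective⇒≤ (cover-cells-injective lefts-are-rights covers-are-lefts))
  ... | no ¬lefts-are-rights | _ =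
    let r , ¬left-is-right = ¬∀⟶∃¬ m LeftIsRight leftIsRight? ¬lefts-are-rights
    in inj₂ (extra-left r ¬left-is-right)
  ... | _ | no ¬covers-are-lefts =
    let p , ¬cover-is-left = ¬∀⟶∃¬ (suc m) CoverIsLeft coverIsLeft? ¬covers-are-lefts
    in inj₂ (extra-cover p ¬cover-is-left)

module Witnesses {q n} (u : Fin q → Fin n → Sym) where

  _kills_ : Slot n → ℕ → Set
  (j , b) kills y = ∃ λ x → toℕ x ≡ y × T (u x j) (bit b) ≡ false

  record Witness (θ : Fin n → Sym) (x : Fin q) : Set where
    field
      slot  : Slot n
      sent       : θ (proj₁ slot) ≡ bit (proj₂ slot)
      kills-zero : slot kills toℕ x

  open Witness

  witness : ∀ {f θ x} → Implements u f θ → (∀ j → θ j ∈ₐ ⋆) → f x ≡ false → Witness θ x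
  witness {x = x} f≡ θ⋆ fx≡false
    with j , Tj≡false ← to ⋀≡false⇔ (trans (sym (f≡ x)) fx≡false)
    with b , θj≡b ← ⋆-killer-is-bit (θ⋆ j) Tj≡false
    = record { slot = j , b ; sent = θj≡b ; kills-zero = x , refl , subst (λ s → T (u x j) s ≡ false) θj≡b Tj≡false }

  killed⇒false : ∀ {f θ j b x} → Implements u f θ → θ j ≡ bit b → T (u x j) (bit b) ≡ false → f x ≡ false
  killed⇒false {x = x} f≡ θj≡b Tx≡false =
    trans (f≡ x) (from (⋀≡false⇔ {n}) (_ , trans (cong (T _) θj≡b) Tx≡false))

  same-cell⇒same-slot : ∀ {θ x x′} (w : Witness θ x) (w′ : Witness θ x′) →
    proj₁ (slot w) ≡ proj₁ (slot w′) → slot w ≡ slot w′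
  same-cell⇒same-slot {θ} w w′ eq =
    cong₂ _,_ eq (bit-injective (trans (sym (sent w)) (trans (cong θ eq) (sent w′))))

implementable⇒slots-bound : ∀ {m n} → GLImplementable ● ⋆ (suc (suc m)) n →
  suc m ≤ n ⊎ suc (suc (suc m)) ≤ n + n
implementable⇒slots-bound {m} {n} (u , ϑ , _ , ϑ⋆ , G≡ , L≡) =
  SlotIntervals.slots-bound _kills_ left right cover
    left-kills left-below right-kills right-above cover-kills cover-below
    (λ {p} {p′} → same-cell⇒same-slot (coverW p) (coverW p′))
  where
  open Witnesses u
  open Witness

  top : Fin (suc (suc m))
  top = fromℕ (suc m)

  inject₁<suc : ∀ i → toℕ (inject₁ {suc m} i) < suc (toℕ i)
  inject₁<suc i = s≤s (ℕ.≤-reflexive (toℕ-inject₁ i))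

  leftW : ∀ i → Witness (ϑ (G (suc i))) (inject₁ i)
  leftW i = witness (G≡ (suc i)) (ϑ⋆ _) (from (G≡false⇔ _ _) (inject₁<suc i))

  rightW : ∀ i → Witness (ϑ (L (inject₁ i))) (suc i)
  rightW i = witness (L≡ (inject₁ i)) (ϑ⋆ _) (from (L≡false⇔ _ _) (inject₁<suc i))

  coverW : ∀ p → Witness (ϑ (G top)) (inject₁ p)
  coverW p = witness (G≡ top) (ϑ⋆ _) (from (G≡false⇔ _ _) (subst (toℕ (inject₁ p) <_)
    (sym (toℕ-fromℕ (suc m))) (ℕ.≤-trans (inject₁<suc p) (s≤s (toℕ≤pred[n] p)))))

  left right cover : Fin (suc m) → Slot n
  left  i = slot (leftW i)
  right i = slot (rightW i)
  cover p = slot (coverW p)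

  left-kills : ∀ i → left i kills toℕ i
  left-kills i = subst (left i kills_) (toℕ-inject₁ i) (kills-zero (leftW i))

  left-below : ∀ i {y} → left i kills y → y ≤ toℕ i
  left-below i (x , refl , k) = s≤s⁻¹ (to (G≡false⇔ _ x) (killed⇒false (G≡ (suc i)) (sent (leftW i)) k))

  right-kills : ∀ i → right i kills suc (toℕ i)
  right-kills i = kills-zero (rightW i)

  right-above : ∀ i {y} → right i kills y → toℕ i < y
  right-above i (x , refl , k) = subst (_< toℕ x) (toℕ-inject₁ i)
    (to (L≡false⇔ _ x) (killed⇒false (L≡ (inject₁ i)) (sent (rightW i)) k))

  cover-kills : ∀ p → cover p kills toℕ p
  cover-kills p = subst (cover p kills_) (toℕ-inject₁ p) (kills-zero (coverW p))

  cover-below : ∀ p {y} → cover p kills y → y ≤ m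
  cover-below p (x , refl , k) = s≤s⁻¹ (subst (toℕ x <_) (toℕ-fromℕ (suc m))
    (to (G≡false⇔ _ x) (killed⇒false (G≡ top) (sent (coverW p)) k)))

suc-bound : ∀ k → suc (bound (suc (suc k))) ≡ suc (suc k) + suc (suc k)
suc-bound k = cong (suc (suc k) +_) (ℕ.+-identityʳ (suc (suc k)))

necessity : ∀ {q n} → 2 ≤ q → GLImplementable ● ⋆ q n → q ≤ bound n
necessity {1} (s≤s ())
necessity {suc (suc m)} {n} _ I = slots⇒bound n (implementable⇒slots-bound I)
  where
  slots⇒bound : ∀ n → suc m ≤ n ⊎ suc (suc (suc m)) ≤ n + n → suc (suc m) ≤ bound n
  slots⇒bound 1 (inj₁ (s≤s z≤n))          = ℕ.≤-refl
  slots⇒bound 1 (inj₂ (s≤s (s≤s ())))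
  slots⇒bound (suc (suc k)) slots = s≤s⁻¹ (subst (suc (suc (suc m)) ≤_) (sym (suc-bound k)) ([ few-cells , id ] slots))
    where
    few-cells : suc m ≤ suc (suc k) → suc (suc (suc m)) ≤ suc (suc k) + suc (suc k)
    few-cells m<n = ℕ.≤-trans (s≤s (s≤s m<n)) (ℕ.+-monoˡ-≤ (suc (suc k)) (s≤s (s≤s z≤n)))

⋆⊆● : ∀ {s} → s ∈ₐ ⋆ → s ∈ₐ ●
⋆⊆● 0∈⋆ = 0∈●
⋆⊆● 1∈⋆ = 1∈●
⋆⊆● *∈⋆ = *∈●

readings-● : ∀ {β q n} → GLImplementable ⋆ β q n → GLImplementable ● β q n
readings-● (u , ϑ , u∈⋆ , rest) = u , ϑ , (λ x j → ⋆⊆● (u∈⋆ x j)) , rest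

implementable-suc : ∀ {α β q n} → s* ∈ₐ α → s* ∈ₐ β → GLImplementable α β q n → GLImplementable α β q (suc n)
implementable-suc *∈α *∈β (u , ϑ , u∈α , ϑ∈β , G≡ , L≡) =
  (λ x → s* ∷ u x) , (λ f → s* ∷ ϑ f) ,
  (λ { x zero → *∈α ; x (suc j) → u∈α x j }) , (λ { f zero → *∈β ; f (suc j) → ϑ∈β f j }) ,
  G≡ , L≡

TableImplements : ∀ {q n} → (Fin q → Fin n → Maybe Bool) → 𝓕 q → (Fin n → Maybe Bool) → Set
TableImplements u f θ = Implements (λ x j → toSym (u x j)) f (λ j → toSym (θ j))

ValidTables : ∀ {q n} (u θG θL : Fin q → Fin n → Maybe Bool) → Set
ValidTables u θG θL = (∀ t → TableImplements u (G t) (θG t)) × (∀ t → TableImplements u (L t) (θL t))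

validTables? : ∀ {q n} (u θG θL : Fin q → Fin n → Maybe Bool) → Dec (ValidTables u θG θL)
validTables? u θG θL =
  all? (λ t → all? (λ x → G t x ≟ᵇ _)) ×-dec all? (λ t → all? (λ x → L t x ≟ᵇ _))

fromTables : ∀ {q n} (u θG θL : Fin q → Fin n → Maybe Bool) → ValidTables u θG θL → GLImplementable ⋆ ⋆ q n
fromTables {q} {n} u θG θL (G-ok , L-ok) =
  (λ x j → toSym (u x j)) , (λ f j → toSym (θ f j)) , (λ x j → toSym∈⋆ (u x j)) , (λ f j → toSym∈⋆ (θ f j)) ,
  (λ t → θ-implements (G t) (inj₁ (t , λ _ → refl))) , (λ t → θ-implements (L t) (inj₂ (t , λ _ → refl)))
  where
  θ : 𝓕 q → Fin n → Maybe Bool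
  θ f with any? (λ t → all? (λ x → f x ≟ᵇ G t x)) | any? (λ t → all? (λ x → f x ≟ᵇ L t x))
  ... | yes (t , _) | _           = θG t
  ... | no _        | yes (t , _) = θL t
  ... | no _        | no _        = λ _ → nothing

  θ-implements : ∀ f → (∃ λ t → f ≗ G t) ⊎ (∃ λ t → f ≗ L t) → TableImplements u f (θ f)
  θ-implements f member
    with any? (λ t → all? (λ x → f x ≟ᵇ G t x)) | any? (λ t → all? (λ x → f x ≟ᵇ L t x))
  ... | yes (t , f≗Gt) | _              = λ x → trans (f≗Gt x) (G-ok t x)
  ... | no _           | yes (t , f≗Lt) = λ x → trans (f≗Lt x) (L-ok t x)
  ... | no ¬G          | no ¬L          = ⊥-elim ([ ¬G , ¬L ] member)

private
  pattern 0ˢ = just false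
  pattern 1ˢ = just true
  pattern *ˢ = nothing

implementable-2-1 : GLImplementable ⋆ ⋆ 2 1
implementable-2-1 = fromTables u θG θL (from-yes (validTables? u θG θL))
  where
  u θG θL : Fin 2 → Fin 1 → Maybe Bool
  u  = (0ˢ ∷ []) ∷ (1ˢ ∷ []) ∷ []
  θG = (*ˢ ∷ []) ∷ (1ˢ ∷ []) ∷ []
  θL = (0ˢ ∷ []) ∷ (*ˢ ∷ []) ∷ []

implementable-3-2 : GLImplementable ⋆ ⋆ 3 2
implementable-3-2 = fromTables u θG θL (from-yes (validTables? u θG θL))
  where
  u θG θL : Fin 3 → Fin 2 → Maybe Bool
  u  = (0ˢ ∷ 0ˢ ∷ []) ∷ (0ˢ ∷ 1ˢ ∷ []) ∷ (1ˢ ∷ 1ˢ ∷ []) ∷ []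
  θG = (*ˢ ∷ *ˢ ∷ []) ∷ (*ˢ ∷ 1ˢ ∷ []) ∷ (1ˢ ∷ *ˢ ∷ []) ∷ []
  θL = (*ˢ ∷ 0ˢ ∷ []) ∷ (0ˢ ∷ *ˢ ∷ []) ∷ (*ˢ ∷ *ˢ ∷ []) ∷ []

⌊n/2⌋<m⇔n<m+m : ∀ n m → ⌊ n /2⌋ < m ⇔ n < m + m
⌊n/2⌋<m⇔n<m+m n             zero    = mk⇔ (λ ()) (λ ())
⌊n/2⌋<m⇔n<m+m 0             (suc m) = mk⇔ (λ _ → z<s) (λ _ → z<s)
⌊n/2⌋<m⇔n<m+m 1             (suc m) = mk⇔ (λ _ → s≤s (subst (0 <_) (sym (ℕ.+-suc m m)) z<s)) (λ _ → z<s)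
⌊n/2⌋<m⇔n<m+m (suc (suc n)) (suc m) =
  mk⇔ (λ h → s≤s (subst (suc n <_) (sym (ℕ.+-suc m m)) (s≤s (to IH (s≤s⁻¹ h)))))
      (λ h → s≤s (from IH (s≤s⁻¹ (subst (suc n <_) (ℕ.+-suc m m) (s≤s⁻¹ h)))))
  where IH = ⌊n/2⌋<m⇔n<m+m n m

m<⌊n/2⌋⇔1+m+m<n : ∀ m n → m < ⌊ n /2⌋ ⇔ suc (m + m) < n
m<⌊n/2⌋⇔1+m+m<n m       0             = mk⇔ (λ ()) (λ ())
m<⌊n/2⌋⇔1+m+m<n m       1             = mk⇔ (λ ()) (λ { (s≤s ()) })
m<⌊n/2⌋⇔1+m+m<n zero    (suc (suc n)) = mk⇔ (λ _ → s≤s (s≤s z≤n)) (λ _ → z<s)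
m<⌊n/2⌋⇔1+m+m<n (suc m) (suc (suc n)) =
  mk⇔ (λ h → s≤s (subst (λ k → suc k < suc n) (sym (ℕ.+-suc m m)) (s≤s (to IH (s≤s⁻¹ h)))))
      (λ h → s≤s (from IH (s≤s⁻¹ (subst (λ k → suc k < suc n) (ℕ.+-suc m m) (s≤s⁻¹ h)))))
  where IH = m<⌊n/2⌋⇔1+m+m<n m n

⌈n/2⌉≡⌊n/2⌋⊎⌈n/2⌉≡1+⌊n/2⌋ : ∀ n → ⌈ n /2⌉ ≡ ⌊ n /2⌋ ⊎ ⌈ n /2⌉ ≡ suc ⌊ n /2⌋
⌈n/2⌉≡⌊n/2⌋⊎⌈n/2⌉≡1+⌊n/2⌋ 0             = inj₁ refl
⌈n/2⌉≡⌊n/2⌋⊎⌈n/2⌉≡1+⌊n/2⌋ 1             = inj₂ refl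
⌈n/2⌉≡⌊n/2⌋⊎⌈n/2⌉≡1+⌊n/2⌋ (suc (suc n)) = map (cong suc) (cong suc) (⌈n/2⌉≡⌊n/2⌋⊎⌈n/2⌉≡1+⌊n/2⌋ n)

data Halves : ℕ → Set where
  even : ∀ a → Halves (a + a)
  odd  : ∀ a → Halves (a + suc a)

halves : ∀ n → Halves n
halves zero = even 0
halves (suc n) with halves n
... | even a = subst Halves (ℕ.+-suc a a) (odd a)
... | odd a  = even (suc a)

-- The edge of parity p touching point x is 2 · incidentHalf p x + p (false = 0, true = 1).
incidentHalf : Bool → ℕ → ℕ
incidentHalf false x = ⌈ x /2⌉
incidentHalf true  x = ⌊ x /2⌋

record Selection (Z : ℕ → Set) : Set₁ where
  field
    parity  : Bool
    Chosen  : ℕ → Set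
    chosen? : Decidable Chosen
    correct : ∀ x → Z x ⇔ Chosen (incidentHalf parity x)

below : ∀ t → Selection (_< t)
below t with halves t
... | even a = record
  { parity = true ; Chosen = _< a ; chosen? = ℕ._<? a
  ; correct = λ x → ⇔-sym (⌊n/2⌋<m⇔n<m+m x a) }
... | odd a = record
  { parity = false ; Chosen = _< suc a ; chosen? = ℕ._<? suc a
  ; correct = λ x → ⇔-sym (⌊n/2⌋<m⇔n<m+m (suc x) (suc a)) ⇔-∘ mk⇔ s≤s s≤s⁻¹ }

above : ∀ t → Selection (t <_)
above t with halves t
... | even a = record
  { parity = false ; Chosen = a <_ ; chosen? = a ℕ.<?_
  ; correct = λ x → ⇔-sym (m<⌊n/2⌋⇔1+m+m<n a (suc x)) ⇔-∘ mk⇔ s≤s s≤s⁻¹ }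
... | odd a = record
  { parity = true ; Chosen = a <_ ; chosen? = a ℕ.<?_
  ; correct = λ x → ⇔-sym (m<⌊n/2⌋⇔1+m+m<n a x)
                    ⇔-∘ mk⇔ (subst (_< x) (ℕ.+-suc a a)) (subst (_< x) (sym (ℕ.+-suc a a))) }

module EdgeCells (k : ℕ) where

  N : ℕ
  N = suc (suc (suc k))

  -- The odd edge of cell j is shifted by two cells, so that no point touches both of its edges.
  ownedHalf : Bool → Fin N → ℕ
  ownedHalf false j             = toℕ j
  ownedHalf true  zero          = suc k
  ownedHalf true  (suc zero)    = suc (suc k)
  ownedHalf true  (suc (suc j)) = toℕ j

  ownedHalf-onto : ∀ p {h} → h < N → ∃ λ j → ownedHalf p j ≡ h
  ownedHalf-onto false h<N = fromℕ< h<N , toℕ-fromℕ< h<N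
  ownedHalf-onto true {h} h<N with ℕ.<-cmp h (suc k)
  ... | tri< h<1+k _ _ = suc (suc (fromℕ< h<1+k)) , toℕ-fromℕ< h<1+k
  ... | tri≈ _ refl _  = zero , refl
  ... | tri> _ _ 1+k<h with refl ← ℕ.≤-antisym (s≤s⁻¹ h<N) 1+k<h = suc zero , refl

  odd-edge-apart : ∀ j → toℕ j ≢ ownedHalf true j × toℕ j ≢ suc (ownedHalf true j)
  odd-edge-apart zero          = (λ ()) , (λ ())
  odd-edge-apart (suc zero)    = (λ ()) , (λ ())
  odd-edge-apart (suc (suc j)) = ℕ.>⇒≢ (ℕ.m<n⇒m<1+n (ℕ.n<1+n _)) , ℕ.>⇒≢ (ℕ.n<1+n _)

  edges-apart : ∀ x j → ⌈ x /2⌉ ≡ toℕ j → ⌊ x /2⌋ ≢ ownedHalf true j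
  edges-apart x j ⌈x/2⌉≡j ⌊x/2⌋≡h with ⌈n/2⌉≡⌊n/2⌋⊎⌈n/2⌉≡1+⌊n/2⌋ x
  ... | inj₁ e = proj₁ (odd-edge-apart j) (trans (sym ⌈x/2⌉≡j) (trans e ⌊x/2⌋≡h))
  ... | inj₂ e = proj₂ (odd-edge-apart j) (trans (sym ⌈x/2⌉≡j) (trans e (cong suc ⌊x/2⌋≡h)))

  reading : ℕ → Fin N → Maybe Bool
  reading x j with ⌈ x /2⌉ ℕ.≟ toℕ j | ⌊ x /2⌋ ℕ.≟ ownedHalf true j
  ... | yes _ | _     = 0ˢ
  ... | no _  | yes _ = 1ˢ
  ... | no _  | no _  = *ˢ

  reading≡just⇔ : ∀ p x j → reading x j ≡ just p ⇔ incidentHalf p x ≡ ownedHalf p j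
  reading≡just⇔ p x j with ⌈ x /2⌉ ℕ.≟ toℕ j | ⌊ x /2⌋ ℕ.≟ ownedHalf true j
  reading≡just⇔ false x j | yes e  | _      = mk⇔ (λ _ → e) (λ _ → refl)
  reading≡just⇔ true  x j | yes e  | _      = mk⇔ (λ ()) (λ e′ → ⊥-elim (edges-apart x j e e′))
  reading≡just⇔ false x j | no ¬e  | yes _  = mk⇔ (λ ()) (λ e → ⊥-elim (¬e e))
  reading≡just⇔ true  x j | no _   | yes e′ = mk⇔ (λ _ → e′) (λ _ → refl)
  reading≡just⇔ false x j | no ¬e  | no _   = mk⇔ (λ ()) (λ e → ⊥-elim (¬e e))
  reading≡just⇔ true  x j | no _   | no ¬e′ = mk⇔ (λ ()) (λ e′ → ⊥-elim (¬e′ e′))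

  selector : ∀ {Z} → Selection Z → Fin N → Maybe Bool
  selector S j = if does (chosen? (ownedHalf parity j)) then just (not parity) else nothing
    where open Selection S

  incidentHalf<N : ∀ p {q} (x : Fin q) → q ≤ bound N → incidentHalf p (toℕ x) < N
  incidentHalf<N false x q≤ = from (⌊n/2⌋<m⇔n<m+m (suc (toℕ x)) N)
    (subst (suc (suc (toℕ x)) ≤_) (suc-bound (suc k)) (s≤s (ℕ.≤-trans (toℕ<n x) q≤)))
  incidentHalf<N true x q≤ = ℕ.≤-<-trans (ℕ.⌊n/2⌋≤⌈n/2⌉ (toℕ x)) (incidentHalf<N false x q≤)

  module _ {Z} (S : Selection Z) where
    open Selection S

    verdict : ℕ → Fin N → Bool
    verdict x j = T (toSym (reading x j)) (toSym (selector S j))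

    cell-kills⇔ : ∀ x j → verdict x j ≡ false
                        ⇔ (incidentHalf parity x ≡ ownedHalf parity j × Chosen (ownedHalf parity j))
    cell-kills⇔ x j = by-choice (chosen? (ownedHalf parity j))
      where
      by-choice : (c? : Dec (Chosen (ownedHalf parity j))) →
        T (toSym (reading x j)) (toSym (if does c? then just (not parity) else nothing)) ≡ false
          ⇔ (incidentHalf parity x ≡ ownedHalf parity j × Chosen (ownedHalf parity j))
      by-choice (yes c) =
        mk⇔ (λ k → to (reading≡just⇔ parity x j) (to T-toSym-bit-not≡false⇔ k) , c)
            (λ (e , _) → from T-toSym-bit-not≡false⇔ (from (reading≡just⇔ parity x j) e))
      by-choice (no ¬c) =
        mk⇔ (λ k → ⊥-elim (T-s*≢false _ k)) (λ (_ , c) → ⊥-elim (¬c c))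

    cells-kill⇔ : ∀ x → incidentHalf parity x < N →
      ⋀ (verdict x) ≡ false ⇔ Chosen (incidentHalf parity x)
    cells-kill⇔ x h<N = mk⇔ to′ from′
      where
      to′ : ⋀ (verdict x) ≡ false → Chosen (incidentHalf parity x)
      to′ ⋀≡false
        with j , kj ← to (⋀≡false⇔ {v = verdict x}) ⋀≡false
        with e , c ← to (cell-kills⇔ x j) kj
        = subst Chosen (sym e) c
      from′ : Chosen (incidentHalf parity x) → ⋀ (verdict x) ≡ false
      from′ c with j , owned≡ ← ownedHalf-onto parity h<N =
        from (⋀≡false⇔ {v = verdict x}) (j , from (cell-kills⇔ x j) (sym owned≡ , subst Chosen (sym owned≡) c))

    selection-implements : ∀ {q} {f : 𝓕 q} → q ≤ bound N →
      (∀ x → f x ≡ false ⇔ Z (toℕ x)) → TableImplements (λ x → reading (toℕ x)) f (selector S)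
    selection-implements q≤ f≡false⇔ x =
      ≡false⇔⇒≡ (⇔-sym (cells-kill⇔ (toℕ x) (incidentHalf<N parity x q≤)) ⇔-∘ (correct (toℕ x) ⇔-∘ f≡false⇔ x))

  implementable : ∀ {q} → q ≤ bound N → GLImplementable ⋆ ⋆ q N
  implementable q≤ =
    fromTables (λ x → reading (toℕ x)) (λ t → selector (below (toℕ t))) (λ t → selector (above (toℕ t)))
      ( (λ t → selection-implements (below (toℕ t)) q≤ (G≡false⇔ t))
      , (λ t → selection-implements (above (toℕ t)) q≤ (L≡false⇔ t)))

sufficiency : ∀ {q n} → 2 ≤ q → q ≤ bound n → GLImplementable ⋆ ⋆ q n
sufficiency {1} (s≤s ())
sufficiency {suc (suc _)} {0} _ ()
sufficiency {2} {1} _ _ = implementable-2-1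
sufficiency {suc (suc (suc _))} {1} _ (s≤s (s≤s ()))
sufficiency {2} {2} _ _ = implementable-suc *∈⋆ *∈⋆ implementable-2-1
sufficiency {3} {2} _ _ = implementable-3-2
sufficiency {suc (suc (suc (suc _)))} {2} _ (s≤s (s≤s (s≤s ())))
sufficiency {n = suc (suc (suc k))} _ q≤bound = EdgeCells.implementable k q≤bound

proposition13 : (q n : ℕ) → 2 ≤ q → 1 ≤ n →
    (GLImplementable ⋆ ⋆ q n ⇔ q ≤ bound n) × (GLImplementable ● ⋆ q n ⇔ q ≤ bound n)
proposition13 q n 2≤q _ =
  mk⇔ (λ I → necessity 2≤q (readings-● I)) (sufficiency 2≤q) ,
  mk⇔ (necessity 2≤q) (λ q≤bound → readings-● (sufficiency 2≤q q≤bound))
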